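{- Let $n\ge1$, $\pi\in\mathcal{B}_{3n}$, and write $T_1(\pi)=\{x_1<\dots<x_n\}$, $T_2(\pi)=\{y_1<\dots<y_n\}$, $T_3(\pi)=\{z_1<\dots<z_n\}$. Then for all $i\in[n]$ and $j\in[n-1]$: (a) $x_i<y_i<z_i$; (b) $x_i\le 3i-2$; (c) $x_j<y_i<x_{j+1}$ if and only if $y_j<z_i<y_{j+1}$. Conversely, given a partition of $[3n]$ into sets $T_1=\{x_1<\dots<x_n\}$, $T_2=\{y_1<\dots<y_n\}$, $T_3=\{z_1<\dots<z_n\}$ satisfying (a), (b), (c), there exists a unique permutation $\pi\in\mathcal{B}_{3n}$ with $T_1(\pi)=T_1$, $T_2(\pi)=T_2$, $T_3(\pi)=T_3$, namely $\pi=\prod_{i=1}^n(x_i,z_i,y_i)$ (in cycle notation).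
   Context: Permutations are written in one-line notation $\pi=\pi_1\cdots\pi_m$, $\pi_i=\pi(i)$; a permutation avoids $\sigma$ if no subsequence is in the same relative order as $\sigma$. $\mathcal{S}^\star_{3n}$ is the set of permutations of $[3n]$ whose cycle decomposition consists only of 3-cycles. If $\{a<b<c\}$ is a 3-cycle of $\pi$, $\pi_a\pi_b\pi_c$ is in relative order 312 or 231, and the cycle is called of the form 312 or 231 accordingly. $\mathcal{B}_{3n}$ is the set of 321-avoiding permutations in $\mathcal{S}^\star_{3n}$ all of whose 3-cycles are of the form 312. For $\pi\in\mathcal{B}_{3n}$, $T_1(\pi),T_2(\pi),T_3(\pi)$ is the partition of $[3n]$ in which a value lies in $T_i(\pi)$ if it is the $i$-th smallest element of its 3-cycle. -}

module Defs where

open import Data.Nat using (ℕ; suc; _*_; _≤_)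
open import Data.Fin using (Fin; toℕ; _<_)
open import Data.Fin.Permutation using (Permutation′; _⟨$⟩ʳ_)
open import Data.Product using (_×_; ∃; _,_)
open import Data.Sum using (_⊎_)
open import Relation.Binary.PropositionalEquality using (_≡_; _≢_)
open import Relation.Nullary using (¬_)

-- Permutations of [m] are bijections Fin m ↔ Fin m (values 0..m-1 stand for 1..m).

Avoids321 : ∀ {m} → Permutation′ m → Set
Avoids321 {m} π = ∀ (i j k : Fin m) → i < j → j < k →
  ¬ ((π ⟨$⟩ʳ k) < (π ⟨$⟩ʳ j) × (π ⟨$⟩ʳ j) < (π ⟨$⟩ʳ i))

OnlyThreeCycles : ∀ {m} → Permutation′ m → Set
OnlyThreeCycles {m} π = ∀ (v : Fin m) →
  (π ⟨$⟩ʳ v) ≢ v × (π ⟨$⟩ʳ (π ⟨$⟩ʳ v)) ≢ v × (π ⟨$⟩ʳ (π ⟨$⟩ʳ (π ⟨$⟩ʳ v))) ≡ v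

IsCycle : ∀ {m} → Permutation′ m → Fin m → Fin m → Fin m → Set
IsCycle π a b c =
  ((π ⟨$⟩ʳ a) ≡ b × (π ⟨$⟩ʳ b) ≡ c × (π ⟨$⟩ʳ c) ≡ a) ⊎
  ((π ⟨$⟩ʳ a) ≡ c × (π ⟨$⟩ʳ c) ≡ b × (π ⟨$⟩ʳ b) ≡ a)

-- every 3-cycle {a<b<c} is of the form 312: π_a π_b π_c in relative order 312,
-- i.e. π_b < π_c < π_a
AllCycles312 : ∀ {m} → Permutation′ m → Set
AllCycles312 {m} π = ∀ (a b c : Fin m) → a < b → b < c → IsCycle π a b c →
  (π ⟨$⟩ʳ b) < (π ⟨$⟩ʳ c) × (π ⟨$⟩ʳ c) < (π ⟨$⟩ʳ a)

InB : (n : ℕ) → Permutation′ (3 * n) → Set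
InB n π = OnlyThreeCycles π × Avoids321 π × AllCycles312 π

-- T₁, T₂, T₃: v is the smallest / middle / largest element of its 3-cycle
-- (its 3-cycle is {v, π v, π (π v)})
InT₁ : ∀ {m} → Permutation′ m → Fin m → Set
InT₁ π v = v < (π ⟨$⟩ʳ v) × v < (π ⟨$⟩ʳ (π ⟨$⟩ʳ v))

InT₂ : ∀ {m} → Permutation′ m → Fin m → Set
InT₂ π v = ((π ⟨$⟩ʳ v) < v × v < (π ⟨$⟩ʳ (π ⟨$⟩ʳ v))) ⊎
           ((π ⟨$⟩ʳ (π ⟨$⟩ʳ v)) < v × v < (π ⟨$⟩ʳ v))

InT₃ : ∀ {m} → Permutation′ m → Fin m → Set
InT₃ π v = (π ⟨$⟩ʳ v) < v × (π ⟨$⟩ʳ (π ⟨$⟩ʳ v)) < v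

StrictInc : ∀ {n m} → (Fin n → Fin m) → Set
StrictInc {n} x = ∀ (i k : Fin n) → i < k → x i < x k

Enumerates : ∀ {n m} → (Fin n → Fin m) → (Fin m → Set) → Set
Enumerates {n} {m} x P = ∀ (v : Fin m) → (P v → ∃ λ i → x i ≡ v) × ((∃ λ i → x i ≡ v) → P v)

IncEnum : ∀ {n m} → (Fin n → Fin m) → (Fin m → Set) → Set
IncEnum x P = StrictInc x × Enumerates x P

IsPartition : ∀ {n m} → (x y z : Fin n → Fin m) → Set
IsPartition {n} {m} x y z =
  (∀ (v : Fin m) → (∃ λ i → x i ≡ v) ⊎ (∃ λ i → y i ≡ v) ⊎ (∃ λ i → z i ≡ v)) ×
  (∀ (i k : Fin n) → x i ≢ y k × x i ≢ z k × y i ≢ z k)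

-- conditions (a), (b), (c), with 0-based indices i ∈ Fin n (i ↔ i+1)
-- and 0-based values (v ↔ v+1); (b) x_i ≤ 3i-2 becomes toℕ (x i) ≤ 3 * toℕ i.
CondA : ∀ {n m} → (x y z : Fin n → Fin m) → Set
CondA {n} x y z = ∀ (i : Fin n) → x i < y i × y i < z i

CondB : ∀ {n m} → (x : Fin n → Fin m) → Set
CondB {n} x = ∀ (i : Fin n) → toℕ (x i) ≤ 3 * toℕ i

CondC : ∀ {n m} → (x y z : Fin n → Fin m) → Set
CondC {n} x y z = ∀ (i j j′ : Fin n) → toℕ j′ ≡ suc (toℕ j) →
  ((x j < y i × y i < x j′) → (y j < z i × z i < y j′)) ×
  ((y j < z i × z i < y j′) → (x j < y i × y i < x j′))

IsCycleProduct : ∀ {n m} → Permutation′ m → (x y z : Fin n → Fin m) → Set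
IsCycleProduct {n} π x y z = ∀ (i : Fin n) →
  (π ⟨$⟩ʳ x i) ≡ z i × (π ⟨$⟩ʳ z i) ≡ y i × (π ⟨$⟩ʳ y i) ≡ x i

-- For π ∈ 𝓑, every 3-cycle {a < b < c} is traversed a ↦ c ↦ b ↦ a, so π maps
-- T₁ to T₃, T₃ to T₂ and T₂ to T₁. Avoiding 321 makes π increasing on T₁ (the excedances) and on
-- T₂ ∪ T₃ (the deficiencies), and a strictly increasing bijection between two increasingly
-- enumerated sets sends the i-th element to the i-th element: π x_i = z_i, π z_i = y_i, π y_i = x_i.
-- Then (a) is the shape of each cycle, (c) says that y_k < z_i ⇔ π y_k < π z_i, i.e. x_k < y_i,
-- and (b) counts: everything below x_i is one of x_k, y_k, z_k with k < i.
--
-- Conditions (a) and (c) force the cycle product (x_i, z_i, y_i) to be increasing on its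
-- deficiencies, which together with increasing excedances is the classical characterisation of
-- 321-avoidance; uniqueness is the forward direction again.
module Submission where

open import Defs
open import Data.Nat using (ℕ; _*_; _≤_)
open import Data.Fin using (Fin)
open import Data.Fin.Permutation using (Permutation′; _⟨$⟩ʳ_)
open import Data.Product using (_×_; Σ)
open import Relation.Binary.PropositionalEquality using (_≡_)

open import Data.Nat.Base as ℕ using (zero; suc; z≤n; s<s)
import Data.Nat.Properties as ℕ
open import Data.Fin.Base as Fin using (Fin′; suc; toℕ; _<_; inject; inject₁; opposite; fromℕ<; combine; remQuot)
import Data.Fin.Properties as Fin
open import Data.Fin.Patterns using (0F; 1F; 2F)
open import Data.Fin.Permutation using (_⟨$⟩ˡ_; inverseˡ; permutation)
open import Data.Product using (∃; ∃₂; _,_; proj₁; proj₂; swap; uncurry)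
open import Data.Sum using (_⊎_; inj₁; inj₂)
open import Function using (_∘_)
open import Relation.Binary.Definitions using (Tri; tri<; tri≈; tri>)
open import Relation.Binary.PropositionalEquality using (_≢_; refl; sym; trans; cong; subst; subst₂; module ≡-Reasoning)
open import Relation.Nullary using (¬_; contradiction; yes; no)

Image : ∀ {n m} → (Fin n → Fin m) → Fin m → Set
Image w v = ∃ λ i → w i ≡ v

Covers : ∀ {n m} → (x y z : Fin n → Fin m) → Set
Covers {m = m} x y z = ∀ (v : Fin m) → Image x v ⊎ Image y v ⊎ Image z v

covers-elim : ∀ {n m} {x y z : Fin n → Fin m} → Covers x y z → (Q : Fin m → Set) →
  (∀ k → Q (x k)) → (∀ k → Q (y k)) → (∀ k → Q (z k)) → ∀ v → Q v
covers-elim cover Q Qx Qy Qz v with cover v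
... | inj₁ (k , refl) = Qx k
... | inj₂ (inj₁ (k , refl)) = Qy k
... | inj₂ (inj₂ (k , refl)) = Qz k

≮∧≢⇒> : ∀ {m} {u v : Fin m} → ¬ (u < v) → u ≢ v → v < u
≮∧≢⇒> u≮v u≢v = Fin.≤∧≢⇒< (ℕ.≮⇒≥ u≮v) (u≢v ∘ sym)

opposite-reverses-< : ∀ {n} {i j : Fin n} → i < j → opposite j < opposite i
opposite-reverses-< {i = i} {j} i<j =
  subst₂ ℕ._<_ (sym (Fin.opposite-prop j)) (sym (Fin.opposite-prop i))
    (ℕ.∸-monoʳ-< (s<s i<j) (Fin.toℕ<n j))

module _ {n m : ℕ} {w : Fin n → Fin m} (w-inc : StrictInc w) where

  strictInc-cancel-< : ∀ {i k} → w i < w k → i < k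
  strictInc-cancel-< {i} {k} wi<wk with Fin.<-cmp i k
  ... | tri< i<k _ _ = i<k
  ... | tri≈ _ refl _ = contradiction wi<wk (Fin.<-irrefl refl)
  ... | tri> _ _ k<i = contradiction (w-inc k i k<i) (Fin.<-asym wi<wk)

  strictInc-injective : ∀ {i k} → w i ≡ w k → i ≡ k
  strictInc-injective {i} {k} wi≡wk with Fin.<-cmp i k
  ... | tri< i<k _ _ = contradiction (w-inc i k i<k) (Fin.<-irrefl wi≡wk)
  ... | tri≈ _ i≡k _ = i≡k
  ... | tri> _ _ k<i = contradiction (w-inc k i k<i) (Fin.<-irrefl (sym wi≡wk))

  strictInc-mono-≤ : ∀ {i k} → toℕ i ≤ toℕ k → w i Fin.≤ w k
  strictInc-mono-≤ i≤k with ℕ.m≤n⇒m<n∨m≡n i≤k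
  ... | inj₁ i<k = ℕ.<⇒≤ (w-inc _ _ i<k)
  ... | inj₂ i≡k = Fin.≤-reflexive (cong w (Fin.toℕ-injective i≡k))

strictInc⇒≤ : ∀ {n m} {w : Fin n → Fin m} → StrictInc w → ∀ i → toℕ i ≤ toℕ (w i)
strictInc⇒≤ w-inc 0F = z≤n
strictInc⇒≤ {w = w} w-inc (suc i) =
  ℕ.≤-<-trans (strictInc⇒≤ {w = w ∘ inject₁} w∘inject₁-inc i)
              (w-inc (inject₁ i) (suc i) (Fin.≤̄⇒inject₁< Fin.≤-refl))
  where
    w∘inject₁-inc : StrictInc (w ∘ inject₁)
    w∘inject₁-inc j k j<k =
      w-inc _ _ (subst₂ ℕ._<_ (sym (Fin.toℕ-inject₁ j)) (sym (Fin.toℕ-inject₁ k)) j<k)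

-- The upper bound s i ≤ i is the lower bound for the reversed map opposite ∘ s ∘ opposite.
strictInc-endo⇒≗id : ∀ {n} {s : Fin n → Fin n} → StrictInc s → ∀ i → s i ≡ i
strictInc-endo⇒≗id {s = s} s-inc i = Fin.≤-antisym (ℕ.≮⇒≥ i≮si) (strictInc⇒≤ s-inc i)
  where
    reversed : StrictInc (opposite ∘ s ∘ opposite)
    reversed j k = opposite-reverses-< ∘ s-inc _ _ ∘ opposite-reverses-<

    i≮si : ¬ (i < s i)
    i≮si i<si = ℕ.<⇒≱ (opposite-reverses-< i<si)
      (subst (λ j → toℕ (opposite i) ≤ toℕ (opposite (s j))) (Fin.opposite-involutive i)
        (strictInc⇒≤ reversed (opposite i)))

strictInc-into-image⇒≗ : ∀ {n m} {g w : Fin n → Fin m} → StrictInc g → StrictInc w →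
  (∀ i → Image w (g i)) → ∀ i → g i ≡ w i
strictInc-into-image⇒≗ {n} {g = g} {w} g-inc w-inc into i = begin
  g i                      ≡⟨ proj₂ (into i) ⟨
  w (index i)              ≡⟨ cong w (strictInc-endo⇒≗id index-inc i) ⟩
  w i                      ∎
  where
    open ≡-Reasoning
    index : Fin n → Fin n
    index = proj₁ ∘ into

    index-inc : StrictInc index
    index-inc i k i<k = strictInc-cancel-< w-inc
      (subst₂ _<_ (sym (proj₂ (into i))) (sym (proj₂ (into k))) (g-inc i k i<k))

covered⇒≤ : ∀ {k m} (g : Fin k → Fin m) (t : Fin m) →
  (∀ v → v < t → Image g v) → toℕ t ≤ k
covered⇒≤ {k} g t covered = Fin.injective⇒≤ {f = preimage} preimage-injective
  where
    inject<t : ∀ (r : Fin′ t) → inject r < t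
    inject<t r = subst (ℕ._< toℕ t) (sym (Fin.toℕ-inject r)) (Fin.toℕ<n r)

    preimage : Fin′ t → Fin k
    preimage r = proj₁ (covered (inject r) (inject<t r))

    preimage-injective : ∀ {r r′} → preimage r ≡ preimage r′ → r ≡ r′
    preimage-injective {r} {r′} eq = Fin.toℕ-injective (begin
      toℕ r                   ≡⟨ Fin.toℕ-inject r ⟨
      toℕ (inject r)          ≡⟨ cong toℕ (proj₂ (covered _ (inject<t r))) ⟨
      toℕ (g (preimage r))    ≡⟨ cong (toℕ ∘ g) eq ⟩
      toℕ (g (preimage r′))   ≡⟨ cong toℕ (proj₂ (covered _ (inject<t r′))) ⟩
      toℕ (inject r′)         ≡⟨ Fin.toℕ-inject r′ ⟩
      toℕ r′                  ∎)
      where open ≡-Reasoning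

module _ {n m : ℕ} {x y z : Fin n → Fin m} (x-inc : StrictInc x) (cover : Covers x y z)
  (condA : CondA x y z) where

  -- The values below x_i are among x_k, y_k, z_k for k < i: at most 3i of them.
  condB-from-cover : CondB x
  condB-from-cover i = covered⇒≤ earlier (x i) below-xᵢ
    where
      enum : Fin 3 → Fin n → Fin m
      enum 0F = x
      enum 1F = y
      enum 2F = z

      earlier : Fin (3 * toℕ i) → Fin m
      earlier = uncurry (λ c r → enum c (inject r)) ∘ remQuot (toℕ i)

      reached : ∀ c k → x k Fin.≤ enum c k → enum c k < x i → Image earlier (enum c k)
      reached c k xₖ≤ <xᵢ = combine c r , (begin
        earlier (combine c r)   ≡⟨ cong (uncurry (λ c r → enum c (inject r))) (Fin.remQuot-combine c r) ⟩
        enum c (inject r)       ≡⟨ cong (enum c) (Fin.toℕ-injective (trans (Fin.toℕ-inject r) (Fin.toℕ-fromℕ< k<i))) ⟩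
        enum c k                ∎)
        where
          open ≡-Reasoning
          k<i : toℕ k ℕ.< toℕ i
          k<i = strictInc-cancel-< x-inc (ℕ.≤-<-trans xₖ≤ <xᵢ)
          r : Fin (toℕ i)
          r = fromℕ< k<i

      below-xᵢ : ∀ v → v < x i → Image earlier v
      below-xᵢ v v<xᵢ with cover v
      ... | inj₁ (k , refl) = reached 0F k Fin.≤-refl v<xᵢ
      ... | inj₂ (inj₁ (k , refl)) = reached 1F k (ℕ.<⇒≤ (proj₁ (condA k))) v<xᵢ
      ... | inj₂ (inj₂ (k , refl)) =
        reached 2F k (ℕ.<⇒≤ (Fin.<-trans (proj₁ (condA k)) (proj₂ (condA k)))) v<xᵢ

-- CondC x y z i is, by definition, SameGap x (y i) y (z i).
SameGap : ∀ {n m} → (P : Fin n → Fin m) → Fin m → (Q : Fin n → Fin m) → Fin m → Set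
SameGap {n} P p Q q = ∀ (j j′ : Fin n) → toℕ j′ ≡ suc (toℕ j) →
  ((P j < p × p < P j′) → (Q j < q × q < Q j′)) ×
  ((Q j < q × q < Q j′) → (P j < p × p < P j′))

SameRank : ∀ {n m} → (P : Fin n → Fin m) → Fin m → (Q : Fin n → Fin m) → Fin m → Set
SameRank {n} P p Q q = ∀ (k : Fin n) → (P k < p → Q k < q) × (Q k < q → P k < p)

Between : ∀ {n m} → (Fin n → Fin m) → Fin m → Set
Between w v = ∃₂ λ j j′ → toℕ j′ ≡ suc (toℕ j) × w j < v × v < w j′

locate : ∀ {n m} (w : Fin n → Fin m) → StrictInc w → ∀ {v} → (∀ j → w j ≢ v) →
  (∀ j → v < w j) ⊎ Between w v ⊎ (∀ j → w j < v)
locate {zero} w w-inc w∌v = inj₂ (inj₂ λ ())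
locate {suc zero} w w-inc {v} w∌v with Fin.<-cmp v (w 0F)
... | tri< v<w₀ _ _ = inj₁ λ { 0F → v<w₀ }
... | tri≈ _ v≡w₀ _ = contradiction (sym v≡w₀) (w∌v 0F)
... | tri> _ _ w₀<v = inj₂ (inj₂ λ { 0F → w₀<v })
locate {suc (suc n)} w w-inc {v} w∌v =
  extend (Fin.<-cmp v (w 0F)) (locate (w ∘ suc) (λ j k → w-inc (suc j) (suc k) ∘ s<s) (w∌v ∘ suc))
  where
    extend : Tri (v < w 0F) (v ≡ w 0F) (w 0F < v) →
      (∀ j → v < w (suc j)) ⊎ Between (w ∘ suc) v ⊎ (∀ j → w (suc j) < v) →
      (∀ j → v < w j) ⊎ Between w v ⊎ (∀ j → w j < v)
    extend (tri< v<w₀ _ _) _ = inj₁ λ j → ℕ.<-≤-trans v<w₀ (strictInc-mono-≤ w-inc z≤n)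
    extend (tri≈ _ v≡w₀ _) _ = contradiction (sym v≡w₀) (w∌v 0F)
    extend (tri> _ _ w₀<v) (inj₁ v<tail) = inj₂ (inj₁ (0F , 1F , refl , w₀<v , v<tail 0F))
    extend (tri> _ _ w₀<v) (inj₂ (inj₁ (j , j′ , j′≡1+j , wj<v , v<wj′))) =
      inj₂ (inj₁ (suc j , suc j′ , cong suc j′≡1+j , wj<v , v<wj′))
    extend (tri> _ _ w₀<v) (inj₂ (inj₂ tail<v)) = inj₂ (inj₂ λ { 0F → w₀<v ; (suc j) → tail<v j })

module _ {n m : ℕ} where

  sameGap-sym : ∀ {P Q : Fin n → Fin m} {p q} → SameGap P p Q q → SameGap Q q P p
  sameGap-sym gap j j′ j′≡1+j = swap (gap j j′ j′≡1+j)

  -- Locate p among the P's: a gap of p transfers to a gap of q, below which Q k lies. If p is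
  -- above all P's then so is q above all Q's, since a gap of q would transfer back and the anchor
  -- Q a < q excludes q below all Q's.
  sameGap⇒sameRankˡ : (P Q : Fin n → Fin m) → ∀ {p q} → StrictInc P → StrictInc Q →
    (∀ j → P j ≢ p) → (∀ j → Q j ≢ q) → ∀ {a} → Q a < q → SameGap P p Q q →
    ∀ k → P k < p → Q k < q
  sameGap⇒sameRankˡ P Q P-inc Q-inc P∌p Q∌q Qa<q gap k Pk<p with locate P P-inc P∌p
  ... | inj₁ p<P = contradiction (p<P k) (Fin.<-asym Pk<p)
  ... | inj₂ (inj₁ (j , j′ , j′≡1+j , Pj<p , p<Pj′)) =
    ℕ.≤-<-trans (strictInc-mono-≤ Q-inc k≤j) (proj₁ (proj₁ (gap j j′ j′≡1+j) (Pj<p , p<Pj′)))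
    where
      k≤j : toℕ k ≤ toℕ j
      k≤j = ℕ.s≤s⁻¹ (subst (toℕ k ℕ.<_) j′≡1+j (strictInc-cancel-< P-inc (Fin.<-trans Pk<p p<Pj′)))
  ... | inj₂ (inj₂ P<p) with locate Q Q-inc Q∌q
  ...   | inj₁ q<Q = contradiction (q<Q _) (Fin.<-asym Qa<q)
  ...   | inj₂ (inj₁ (j , j′ , j′≡1+j , Qj<q , q<Qj′)) =
          contradiction (P<p j′) (Fin.<-asym (proj₂ (proj₂ (gap j j′ j′≡1+j) (Qj<q , q<Qj′))))
  ...   | inj₂ (inj₂ Q<q) = Q<q k

  sameGap⇒sameRank : (P Q : Fin n → Fin m) → ∀ {p q} → StrictInc P → StrictInc Q →
    (∀ j → P j ≢ p) → (∀ j → Q j ≢ q) → ∀ a → P a < p → Q a < q →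
    SameGap P p Q q → SameRank P p Q q
  sameGap⇒sameRank P Q P-inc Q-inc P∌p Q∌q a Pa<p Qa<q gap k =
    sameGap⇒sameRankˡ P Q P-inc Q-inc P∌p Q∌q Qa<q gap k ,
    sameGap⇒sameRankˡ Q P Q-inc P-inc Q∌q P∌p Pa<p (sameGap-sym gap) k

  sameRank⇒sameGap : ∀ {P Q : Fin n → Fin m} {p q} → (∀ j → P j ≢ p) → (∀ j → Q j ≢ q) →
    SameRank P p Q q → SameGap P p Q q
  sameRank⇒sameGap {P} {Q} P∌p Q∌q rank j j′ _ =
    (λ (Pj<p , p<Pj′) → proj₁ (rank j) Pj<p ,
      ≮∧≢⇒> (Fin.<-asym p<Pj′ ∘ proj₂ (rank j′)) (Q∌q j′)) ,
    (λ (Qj<q , q<Qj′) → proj₂ (rank j) Qj<q ,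
      ≮∧≢⇒> (Fin.<-asym q<Qj′ ∘ proj₁ (rank j′)) (P∌p j′))

module _ {n m : ℕ} {x y z : Fin n → Fin m} {P₁ P₂ P₃ : Fin m → Set} (cover : Covers x y z)
  (P₁⇒¬P₂ : ∀ {v} → P₁ v → ¬ P₂ v) (P₁⇒¬P₃ : ∀ {v} → P₁ v → ¬ P₃ v) (P₂⇒¬P₃ : ∀ {v} → P₂ v → ¬ P₃ v)
  (x∈P₁ : ∀ i → P₁ (x i)) (y∈P₂ : ∀ i → P₂ (y i)) (z∈P₃ : ∀ i → P₃ (z i)) where

  enumerates₁ : Enumerates x P₁
  enumerates₁ v = from , λ { (i , refl) → x∈P₁ i }
    where
      from : P₁ v → Image x v
      from P₁v with cover v
      ... | inj₁ x∋v = x∋v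
      ... | inj₂ (inj₁ (k , refl)) = contradiction (y∈P₂ k) (P₁⇒¬P₂ P₁v)
      ... | inj₂ (inj₂ (k , refl)) = contradiction (z∈P₃ k) (P₁⇒¬P₃ P₁v)

  enumerates₂ : Enumerates y P₂
  enumerates₂ v = from , λ { (i , refl) → y∈P₂ i }
    where
      from : P₂ v → Image y v
      from P₂v with cover v
      ... | inj₁ (k , refl) = contradiction P₂v (P₁⇒¬P₂ (x∈P₁ k))
      ... | inj₂ (inj₁ y∋v) = y∋v
      ... | inj₂ (inj₂ (k , refl)) = contradiction (z∈P₃ k) (P₂⇒¬P₃ P₂v)

  enumerates₃ : Enumerates z P₃
  enumerates₃ v = from , λ { (i , refl) → z∈P₃ i }
    where
      from : P₃ v → Image z v
      from P₃v with cover v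
      ... | inj₁ (k , refl) = contradiction P₃v (P₁⇒¬P₃ (x∈P₁ k))
      ... | inj₂ (inj₁ (k , refl)) = contradiction P₃v (P₂⇒¬P₃ (y∈P₂ k))
      ... | inj₂ (inj₂ z∋v) = z∋v

module _ {m : ℕ} (π : Permutation′ m) where

  private
    p : Fin m → Fin m
    p v = π ⟨$⟩ʳ v

  ⟨$⟩ʳ-injective : ∀ {u v} → p u ≡ p v → u ≡ v
  ⟨$⟩ʳ-injective {u} {v} eq = begin
    u                ≡⟨ inverseˡ π ⟨
    π ⟨$⟩ˡ p u       ≡⟨ cong (π ⟨$⟩ˡ_) eq ⟩
    π ⟨$⟩ˡ p v       ≡⟨ inverseˡ π ⟩
    v                ∎
    where open ≡-Reasoning

  InT₁⇒¬InT₂ : ∀ {v} → InT₁ π v → ¬ InT₂ π v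
  InT₁⇒¬InT₂ (v<pv , _) (inj₁ (pv<v , _)) = Fin.<-asym v<pv pv<v
  InT₁⇒¬InT₂ (_ , v<ppv) (inj₂ (ppv<v , _)) = Fin.<-asym v<ppv ppv<v

  InT₁⇒¬InT₃ : ∀ {v} → InT₁ π v → ¬ InT₃ π v
  InT₁⇒¬InT₃ (v<pv , _) (pv<v , _) = Fin.<-asym v<pv pv<v

  InT₂⇒¬InT₃ : ∀ {v} → InT₂ π v → ¬ InT₃ π v
  InT₂⇒¬InT₃ (inj₁ (_ , v<ppv)) (_ , ppv<v) = Fin.<-asym v<ppv ppv<v
  InT₂⇒¬InT₃ (inj₂ (_ , v<pv)) (pv<v , _) = Fin.<-asym v<pv pv<v

  excedance-dichotomy : ∀ v → v < p v ⊎ p v Fin.≤ v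
  excedance-dichotomy v with v Fin.<? p v
  ... | yes v<pv = inj₁ v<pv
  ... | no v≮pv = inj₂ (ℕ.≮⇒≥ v≮pv)

  -- One direction of the classical characterisation of 321-avoiding permutations.
  avoids321-from-monotone :
    (∀ a b → a < b → a < p a → b < p b → ¬ (p b < p a)) →
    (∀ c c′ → c < c′ → p c Fin.≤ c → p c′ Fin.≤ c′ → ¬ (p c′ < p c)) →
    Avoids321 π
  avoids321-from-monotone excedances others i j k i<j j<k (pk<pj , pj<pi)
    with excedance-dichotomy j
  ... | inj₁ j<pj with excedance-dichotomy i
  ...   | inj₁ i<pi = excedances i j i<j i<pi j<pj pj<pi
  ...   | inj₂ pi≤i = Fin.<-asym j<pj (ℕ.<-≤-trans pj<pi (Fin.≤-trans pi≤i (ℕ.<⇒≤ i<j)))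
  avoids321-from-monotone excedances others i j k i<j j<k (pk<pj , pj<pi)
      | inj₂ pj≤j with excedance-dichotomy k
  ...   | inj₁ k<pk = Fin.<-asym k<pk (ℕ.<-≤-trans pk<pj (Fin.≤-trans pj≤j (ℕ.<⇒≤ j<k)))
  ...   | inj₂ pk≤k = others j k j<k pj≤j pk≤k pk<pj

module ThreeCycles {m : ℕ} (π : Permutation′ m) (three : OnlyThreeCycles π) where

  private
    p : Fin m → Fin m
    p v = π ⟨$⟩ʳ v

  p³≗id : ∀ v → p (p (p v)) ≡ v
  p³≗id v = proj₂ (proj₂ (three v))

  InT-trichotomy : ∀ v → InT₁ π v ⊎ InT₂ π v ⊎ InT₃ π v
  InT-trichotomy v with Fin.<-cmp v (p v) | Fin.<-cmp v (p (p v))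
  ... | tri≈ _ v≡pv _ | _ = contradiction (sym v≡pv) (proj₁ (three v))
  ... | _ | tri≈ _ v≡ppv _ = contradiction (sym v≡ppv) (proj₁ (proj₂ (three v)))
  ... | tri< v<pv _ _ | tri< v<ppv _ _ = inj₁ (v<pv , v<ppv)
  ... | tri< v<pv _ _ | tri> _ _ ppv<v = inj₂ (inj₁ (inj₂ (ppv<v , v<pv)))
  ... | tri> _ _ pv<v | tri< v<ppv _ _ = inj₂ (inj₁ (inj₁ (pv<v , v<ppv)))
  ... | tri> _ _ pv<v | tri> _ _ ppv<v = inj₂ (inj₂ (pv<v , ppv<v))

  -- In a 312 cycle {a < b < c} the order of traversal is a ↦ c ↦ b ↦ a.
  module _ (all312 : AllCycles312 π) where

    InT₁⇒InT₃-image : ∀ {v} → InT₁ π v → InT₃ π (p v)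
    InT₁⇒InT₃-image {v} (v<pv , v<ppv) = ppv<pv , subst (_< p v) (sym (p³≗id v)) v<pv
      where
        ppv<pv : p (p v) < p v
        ppv<pv with Fin.<-cmp (p (p v)) (p v)
        ... | tri< ppv<pv _ _ = ppv<pv
        ... | tri≈ _ ppv≡pv _ = contradiction (⟨$⟩ʳ-injective π ppv≡pv) (proj₁ (three v))
        ... | tri> _ _ pv<ppv = contradiction
                (subst (p (p v) <_) (p³≗id v) (proj₁ (all312 v (p v) (p (p v)) v<pv pv<ppv (inj₁ (refl , refl , p³≗id v)))))
                (Fin.<-asym v<ppv)

    InT₃⇒InT₂-image : ∀ {v} → InT₃ π v → InT₂ π (p v)
    InT₃⇒InT₂-image {v} (pv<v , ppv<v) = inj₁ (ppv<pv , subst (p v <_) (sym (p³≗id v)) pv<v)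
      where
        ppv<pv : p (p v) < p v
        ppv<pv with Fin.<-cmp (p (p v)) (p v)
        ... | tri< ppv<pv _ _ = ppv<pv
        ... | tri≈ _ ppv≡pv _ = contradiction (⟨$⟩ʳ-injective π ppv≡pv) (proj₁ (three v))
        ... | tri> _ _ pv<ppv = contradiction
                (subst (_< p v) (p³≗id v) (proj₁ (all312 (p v) (p (p v)) v pv<ppv ppv<v (inj₁ (refl , p³≗id v , refl)))))
                (Fin.<-asym pv<v)

  module _ (avoids : Avoids321 π) where

    private
      <-from-≯ : ∀ {a b} → a < b → ¬ (p b < p a) → p a < p b
      <-from-≯ a<b pb≮pa = ≮∧≢⇒> pb≮pa (Fin.<⇒≢ a<b ∘ ⟨$⟩ʳ-injective π ∘ sym)

    -- 321 at a < a′ < p (p a′), whose last value is a′ itself.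
    increasing-into-T₁ : ∀ {a a′} → a < a′ → InT₁ π a′ → p a < p a′
    increasing-into-T₁ {a} {a′} a<a′ (a′<pa′ , a′<ppa′) = <-from-≯ a<a′ λ pa′<pa →
      avoids a a′ (p (p a′)) a<a′ a′<ppa′ (subst (_< p a′) (sym (p³≗id a′)) a′<pa′ , pa′<pa)

    -- 321 at p (p c) < c < c′ or at p c < c < c′, depending on the side of c on which p (p c) lies.
    increasing-from-deficiency : ∀ {c c′} → c < c′ → p c < c → p c < p c′
    increasing-from-deficiency {c} {c′} c<c′ pc<c = <-from-≯ c<c′ pc′≮pc
      where
        pc′≮pc : ¬ (p c′ < p c)
        pc′≮pc pc′<pc with Fin.<-cmp (p (p c)) c
        ... | tri< ppc<c _ _ = avoids (p (p c)) c c′ ppc<c c<c′ (pc′<pc , subst (p c <_) (sym (p³≗id c)) pc<c)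
        ... | tri≈ _ ppc≡c _ = proj₁ (proj₂ (three c)) ppc≡c
        ... | tri> _ _ c<ppc = avoids (p c) c c′ pc<c c<c′ (pc′<pc , Fin.<-trans pc<c c<ppc)

    deficiency-reflects-< : ∀ {c c′} → p c′ < c′ → p c < p c′ → c < c′
    deficiency-reflects-< {c} {c′} pc′<c′ pc<pc′ with Fin.<-cmp c c′
    ... | tri< c<c′ _ _ = c<c′
    ... | tri≈ _ refl _ = contradiction pc<pc′ (Fin.<-irrefl refl)
    ... | tri> _ _ c′<c = contradiction (increasing-from-deficiency c′<c pc′<c′) (Fin.<-asym pc<pc′)

module Enumerated {n m : ℕ} (π : Permutation′ m) (three : OnlyThreeCycles π)
  (avoids : Avoids321 π) (all312 : AllCycles312 π) (x y z : Fin n → Fin m)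
  (x-enum : IncEnum x (InT₁ π)) (y-enum : IncEnum y (InT₂ π)) (z-enum : IncEnum z (InT₃ π)) where

  open ThreeCycles π three
  open ≡-Reasoning

  private
    p : Fin m → Fin m
    p v = π ⟨$⟩ʳ v

  x∈T₁ : ∀ i → InT₁ π (x i)
  x∈T₁ i = proj₂ (proj₂ x-enum (x i)) (i , refl)

  y∈T₂ : ∀ i → InT₂ π (y i)
  y∈T₂ i = proj₂ (proj₂ y-enum (y i)) (i , refl)

  z∈T₃ : ∀ i → InT₃ π (z i)
  z∈T₃ i = proj₂ (proj₂ z-enum (z i)) (i , refl)

  π∘x≗z : ∀ i → p (x i) ≡ z i
  π∘x≗z = strictInc-into-image⇒≗
    (λ i k i<k → increasing-into-T₁ avoids (proj₁ x-enum i k i<k) (x∈T₁ k))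
    (proj₁ z-enum)
    (λ i → proj₁ (proj₂ z-enum (p (x i))) (InT₁⇒InT₃-image all312 (x∈T₁ i)))

  π∘z≗y : ∀ i → p (z i) ≡ y i
  π∘z≗y = strictInc-into-image⇒≗
    (λ i k i<k → increasing-from-deficiency avoids (proj₁ z-enum i k i<k) (proj₁ (z∈T₃ i)))
    (proj₁ y-enum)
    (λ i → proj₁ (proj₂ y-enum (p (z i))) (InT₃⇒InT₂-image all312 (z∈T₃ i)))

  π∘y≗x : ∀ i → p (y i) ≡ x i
  π∘y≗x i = begin
    p (y i)            ≡⟨ cong p (π∘z≗y i) ⟨
    p (p (z i))        ≡⟨ cong (p ∘ p) (π∘x≗z i) ⟨
    p (p (p (x i)))    ≡⟨ p³≗id (x i) ⟩
    x i                ∎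

  condA : CondA x y z
  condA i = subst (x i <_) π²∘x≗y (proj₂ (x∈T₁ i)) , subst (_< z i) (π∘z≗y i) (proj₁ (z∈T₃ i))
    where
      π²∘x≗y : p (p (x i)) ≡ y i
      π²∘x≗y = trans (cong p (π∘x≗z i)) (π∘z≗y i)

  covers : Covers x y z
  covers v with InT-trichotomy v
  ... | inj₁ T₁v = inj₁ (proj₁ (proj₂ x-enum v) T₁v)
  ... | inj₂ (inj₁ T₂v) = inj₂ (inj₁ (proj₁ (proj₂ y-enum v) T₂v))
  ... | inj₂ (inj₂ T₃v) = inj₂ (inj₂ (proj₁ (proj₂ z-enum v) T₃v))

  condB : CondB x
  condB = condB-from-cover (proj₁ x-enum) covers condA

  sameRank : ∀ i → SameRank x (y i) y (z i)
  sameRank i k =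
    (λ xₖ<yᵢ → deficiency-reflects-< avoids (proj₁ (z∈T₃ i))
                 (subst₂ _<_ (sym (π∘y≗x k)) (sym (π∘z≗y i)) xₖ<yᵢ)) ,
    (λ yₖ<zᵢ → subst₂ _<_ (π∘y≗x k) (π∘z≗y i)
                 (increasing-from-deficiency avoids yₖ<zᵢ (subst (_< y k) (sym (π∘y≗x k)) (proj₁ (condA k)))))

  condC : CondC x y z
  condC i = sameRank⇒sameGap
    (λ j xⱼ≡yᵢ → InT₁⇒¬InT₂ π (x∈T₁ j) (subst (InT₂ π) (sym xⱼ≡yᵢ) (y∈T₂ i)))
    (λ j yⱼ≡zᵢ → InT₂⇒¬InT₃ π (y∈T₂ j) (subst (InT₃ π) (sym yⱼ≡zᵢ) (z∈T₃ i)))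
    (sameRank i)

module CycleProduct {n m : ℕ} (x y z : Fin n → Fin m)
  (x-inc : StrictInc x) (y-inc : StrictInc y) (z-inc : StrictInc z)
  (partition : IsPartition x y z) (condA : CondA x y z) (condC : CondC x y z) where

  covers : Covers x y z
  covers = proj₁ partition

  x≢y : ∀ i k → x i ≢ y k
  x≢y i k = proj₁ (proj₂ partition i k)

  x≢z : ∀ i k → x i ≢ z k
  x≢z i k = proj₁ (proj₂ (proj₂ partition i k))

  y≢z : ∀ i k → y i ≢ z k
  y≢z i k = proj₂ (proj₂ (proj₂ partition i k))

  x<z : ∀ k → x k < z k
  x<z k = Fin.<-trans (proj₁ (condA k)) (proj₂ (condA k))

  f : Fin m → Fin m
  f v with covers v
  ... | inj₁ (k , _) = z k
  ... | inj₂ (inj₁ (k , _)) = x k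
  ... | inj₂ (inj₂ (k , _)) = y k

  f∘x≗z : ∀ k → f (x k) ≡ z k
  f∘x≗z k with covers (x k)
  ... | inj₁ (k′ , xk′≡xk) = cong z (strictInc-injective x-inc xk′≡xk)
  ... | inj₂ (inj₁ (k′ , yk′≡xk)) = contradiction (sym yk′≡xk) (x≢y k k′)
  ... | inj₂ (inj₂ (k′ , zk′≡xk)) = contradiction (sym zk′≡xk) (x≢z k k′)

  f∘y≗x : ∀ k → f (y k) ≡ x k
  f∘y≗x k with covers (y k)
  ... | inj₁ (k′ , xk′≡yk) = contradiction xk′≡yk (x≢y k′ k)
  ... | inj₂ (inj₁ (k′ , yk′≡yk)) = cong x (strictInc-injective y-inc yk′≡yk)
  ... | inj₂ (inj₂ (k′ , zk′≡yk)) = contradiction (sym zk′≡yk) (y≢z k k′)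

  f∘z≗y : ∀ k → f (z k) ≡ y k
  f∘z≗y k with covers (z k)
  ... | inj₁ (k′ , xk′≡zk) = contradiction xk′≡zk (x≢z k′ k)
  ... | inj₂ (inj₁ (k′ , yk′≡zk)) = contradiction yk′≡zk (y≢z k′ k)
  ... | inj₂ (inj₂ (k′ , zk′≡zk)) = cong y (strictInc-injective z-inc zk′≡zk)

  orbit : ∀ {a b c} → f a ≡ b → f b ≡ c → f c ≡ a → b ≢ a → c ≢ a →
    f a ≢ a × f (f a) ≢ a × f (f (f a)) ≡ a
  orbit {a} {b} {c} fa≡b fb≡c fc≡a b≢a c≢a =
    b≢a ∘ trans (sym fa≡b) ,
    c≢a ∘ trans (sym f²a≡c) ,
    trans (cong f f²a≡c) fc≡a
    where
      f²a≡c : f (f a) ≡ c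
      f²a≡c = trans (cong f fa≡b) fb≡c

  f-orbits : ∀ v → f v ≢ v × f (f v) ≢ v × f (f (f v)) ≡ v
  f-orbits = covers-elim covers _
    (λ k → orbit (f∘x≗z k) (f∘z≗y k) (f∘y≗x k) (x≢z k k ∘ sym) (x≢y k k ∘ sym))
    (λ k → orbit (f∘y≗x k) (f∘x≗z k) (f∘z≗y k) (x≢y k k) (y≢z k k ∘ sym))
    (λ k → orbit (f∘z≗y k) (f∘y≗x k) (f∘x≗z k) (y≢z k k) (x≢z k k))

  π : Permutation′ m
  π = permutation f (f ∘ f) (proj₂ ∘ proj₂ ∘ f-orbits) (proj₂ ∘ proj₂ ∘ f-orbits)

  excedance⇒x : ∀ {a} → a < f a → Image x a
  excedance⇒x {a} = covers-elim covers (λ v → v < f v → Image x v)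
    (λ k _ → k , refl)
    (λ k yₖ<fyₖ → contradiction (subst (y k <_) (f∘y≗x k) yₖ<fyₖ) (Fin.<-asym (proj₁ (condA k))))
    (λ k zₖ<fzₖ → contradiction (subst (z k <_) (f∘z≗y k) zₖ<fzₖ) (Fin.<-asym (proj₂ (condA k))))
    a

  nonExcedance⇒y⊎z : ∀ {c} → f c Fin.≤ c → Image y c ⊎ Image z c
  nonExcedance⇒y⊎z {c} = covers-elim covers (λ v → f v Fin.≤ v → Image y v ⊎ Image z v)
    (λ k fxₖ≤xₖ → contradiction (subst (Fin._≤ x k) (f∘x≗z k) fxₖ≤xₖ) (ℕ.<⇒≱ (x<z k)))
    (λ k _ → inj₁ (k , refl))
    (λ k _ → inj₂ (k , refl))
    c

  sameRank : ∀ i → SameRank x (y i) y (z i)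
  sameRank i = sameGap⇒sameRank x y x-inc y-inc (λ j → x≢y j i) (λ j → y≢z j i)
    i (proj₁ (condA i)) (proj₂ (condA i)) (condC i)

  excedances-increasing : ∀ a b → a < b → a < f a → b < f b → ¬ (f b < f a)
  excedances-increasing a b a<b a<fa b<fb with excedance⇒x a<fa | excedance⇒x b<fb
  ... | k , refl | k′ , refl rewrite f∘x≗z k | f∘x≗z k′ =
    Fin.<-asym (z-inc k k′ (strictInc-cancel-< x-inc a<b))

  nonExcedances-increasing : ∀ c c′ → c < c′ → f c Fin.≤ c → f c′ Fin.≤ c′ → ¬ (f c′ < f c)
  nonExcedances-increasing c c′ c<c′ fc≤c fc′≤c′
    with nonExcedance⇒y⊎z fc≤c | nonExcedance⇒y⊎z fc′≤c′
  ... | inj₁ (k , refl) | inj₁ (k′ , refl) rewrite f∘y≗x k | f∘y≗x k′ =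
    Fin.<-asym (x-inc k k′ (strictInc-cancel-< y-inc c<c′))
  ... | inj₂ (k , refl) | inj₂ (k′ , refl) rewrite f∘z≗y k | f∘z≗y k′ =
    Fin.<-asym (y-inc k k′ (strictInc-cancel-< z-inc c<c′))
  ... | inj₁ (k , refl) | inj₂ (k′ , refl) rewrite f∘y≗x k | f∘z≗y k′ =
    Fin.<-asym (proj₂ (sameRank k′ k) c<c′)
  ... | inj₂ (k , refl) | inj₁ (k′ , refl) rewrite f∘z≗y k | f∘y≗x k′ =
    λ xₖ′<yₖ → Fin.<-asym c<c′ (proj₁ (sameRank k k′) xₖ′<yₖ)

  avoids : Avoids321 π
  avoids = avoids321-from-monotone π excedances-increasing nonExcedances-increasing

  all312 : AllCycles312 π
  all312 a b c a<b b<c (inj₂ (fa≡c , fc≡b , fb≡a)) =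
    subst₂ _<_ (sym fb≡a) (sym fc≡b) a<b , subst₂ _<_ (sym fc≡b) (sym fa≡c) b<c
  all312 a b c a<b b<c (inj₁ (fa≡b , fb≡c , _))
    with excedance⇒x (subst (a <_) (sym fa≡b) a<b)
  ... | k , refl = contradiction (subst₂ _<_ b≡zₖ c≡yₖ b<c) (Fin.<-asym (proj₂ (condA k)))
    where
      b≡zₖ : b ≡ z k
      b≡zₖ = trans (sym fa≡b) (f∘x≗z k)
      c≡yₖ : c ≡ y k
      c≡yₖ = trans (sym fb≡c) (trans (cong f b≡zₖ) (f∘z≗y k))

  x∈T₁ : ∀ k → InT₁ π (x k)
  x∈T₁ k rewrite f∘x≗z k | f∘z≗y k = x<z k , proj₁ (condA k)

  y∈T₂ : ∀ k → InT₂ π (y k)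
  y∈T₂ k rewrite f∘y≗x k | f∘x≗z k = inj₁ (proj₁ (condA k) , proj₂ (condA k))

  z∈T₃ : ∀ k → InT₃ π (z k)
  z∈T₃ k rewrite f∘z≗y k | f∘y≗x k = proj₂ (condA k) , x<z k

  x-enumerates : Enumerates x (InT₁ π)
  x-enumerates = enumerates₁ covers (InT₁⇒¬InT₂ π) (InT₁⇒¬InT₃ π) (InT₂⇒¬InT₃ π) x∈T₁ y∈T₂ z∈T₃

  y-enumerates : Enumerates y (InT₂ π)
  y-enumerates = enumerates₂ covers (InT₁⇒¬InT₂ π) (InT₁⇒¬InT₃ π) (InT₂⇒¬InT₃ π) x∈T₁ y∈T₂ z∈T₃

  z-enumerates : Enumerates z (InT₃ π)
  z-enumerates = enumerates₃ covers (InT₁⇒¬InT₂ π) (InT₁⇒¬InT₃ π) (InT₂⇒¬InT₃ π) x∈T₁ y∈T₂ z∈T₃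

  isCycleProduct : IsCycleProduct π x y z
  isCycleProduct i = f∘x≗z i , f∘z≗y i , f∘y≗x i

  unique : (π′ : Permutation′ m) → OnlyThreeCycles π′ × Avoids321 π′ × AllCycles312 π′ →
    Enumerates x (InT₁ π′) → Enumerates y (InT₂ π′) → Enumerates z (InT₃ π′) →
    ∀ v → π′ ⟨$⟩ʳ v ≡ π ⟨$⟩ʳ v
  unique π′ (three′ , avoids′ , all312′) x-enum y-enum z-enum =
    covers-elim covers (λ v → π′ ⟨$⟩ʳ v ≡ f v)
      (λ k → trans (E.π∘x≗z k) (sym (f∘x≗z k)))
      (λ k → trans (E.π∘y≗x k) (sym (f∘y≗x k)))
      (λ k → trans (E.π∘z≗y k) (sym (f∘z≗y k)))
    where
      module E = Enumerated π′ three′ avoids′ all312′ x y z (x-inc , x-enum) (y-inc , y-enum) (z-inc , z-enum)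

lemma4p3 : (n : ℕ) → 1 ≤ n →
    ((π : Permutation′ (3 * n)) → InB n π →
      (x y z : Fin n → Fin (3 * n)) →
      IncEnum x (InT₁ π) → IncEnum y (InT₂ π) → IncEnum z (InT₃ π) →
      CondA x y z × CondB x × CondC x y z)
    ×
    ((x y z : Fin n → Fin (3 * n)) →
      StrictInc x → StrictInc y → StrictInc z → IsPartition x y z →
      CondA x y z → CondB x → CondC x y z →
      Σ (Permutation′ (3 * n)) λ π →
        InB n π ×
        Enumerates x (InT₁ π) × Enumerates y (InT₂ π) × Enumerates z (InT₃ π) ×
        IsCycleProduct π x y z ×
        ((π′ : Permutation′ (3 * n)) → InB n π′ →
          Enumerates x (InT₁ π′) → Enumerates y (InT₂ π′) → Enumerates z (InT₃ π′) →
          (v : Fin (3 * n)) → (π′ ⟨$⟩ʳ v) ≡ (π ⟨$⟩ʳ v)))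
lemma4p3 n _ =
  (λ π (three , avoids , all312) x y z x-enum y-enum z-enum →
    let open Enumerated π three avoids all312 x y z x-enum y-enum z-enum
    in condA , condB , condC) ,
  (λ x y z x-inc y-inc z-inc partition condA _ condC →
    let open CycleProduct x y z x-inc y-inc z-inc partition condA condC
    in π , (f-orbits , avoids , all312) ,
       x-enumerates , y-enumerates , z-enumerates , isCycleProduct , unique)
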